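{- Let $G=(V,E)$ be a graph. For every $e=\{u,v\}\in E$, \begin{align*} D(G,x)=\frac{1}{(1+x)^2}\Big[&x(1+x)\big(D(G-v,x)+D(G-u,x)\big)\\ &+(1-x)D(G+\{u,\cdot\}-v,x)-(1+x)D(G-e+\{u,\cdot\},x)\\ &+(1-x)D(G-u+\{v,\cdot\},x)-(1+x)D(G-e+\{v,\cdot\},x)\\ &+(1+x)^2D(G-e,x)+2D(G-e+\{u,\cdot\}+\{v,\cdot\},x)-2xD(G-u-v,x)\Big]. \end{align*}
   Context: $D(G,x)$ is the domination polynomial of $G$. $G-v$ denotes vertex deletion, $G-e$ edge deletion, and $G+\{u,\cdot\}$ denotes appending a new vertex $u'$ together with the edge $\{u,u'\}$. -}

module Defs where

open import Data.Nat as ℕ using (ℕ; zero; suc; _≡ᵇ_)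
open import Data.Integer as ℤ using (ℤ; +_)
open import Data.Bool using (Bool; true; false; _∧_; _∨_; not; if_then_else_)
open import Data.Fin using (Fin; zero; suc; _≟_)
open import Data.List using (List; []; _∷_; map; _++_)
open import Relation.Nullary.Decidable using (⌊_⌋)
open import Relation.Binary.PropositionalEquality using (_≡_)

-- A graph on the ambient index set Fin N consists of a
-- vertex set V (given by its characteristic function `present`) and an
-- adjacency relation `adj`.  Only adjacencies between present vertices
-- matter.  Vertex deletion removes a vertex from V; appending a pendant
-- vertex enlarges the ambient set to Fin (suc N), the new vertex being
-- `zero` and the old vertex i becoming `suc i`.

record Graph (N : ℕ) : Set where
  constructor graph
  field
    present : Fin N → Bool
    adj     : Fin N → Fin N → Bool
open Graph public

record IsSimple {N : ℕ} (G : Graph N) : Set where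
  field
    adj-sym     : ∀ i j → adj G i j ≡ adj G j i
    adj-irrefl  : ∀ i → adj G i i ≡ false

record IsEdge {N : ℕ} (G : Graph N) (u v : Fin N) : Set where
  field
    u-present : present G u ≡ true
    v-present : present G v ≡ true
    uv-adj    : adj G u v ≡ true

_==_ : ∀ {N} → Fin N → Fin N → Bool
i == j = ⌊ i ≟ j ⌋

delV : ∀ {N} → Graph N → Fin N → Graph N
delV G v = graph (λ i → present G i ∧ not (i == v)) (adj G)

delE : ∀ {N} → Graph N → Fin N → Fin N → Graph N
delE G u v = graph (present G)
  (λ i j → adj G i j ∧ not ((i == u ∧ j == v) ∨ (i == v ∧ j == u)))

pend : ∀ {N} → Graph N → Fin N → Graph (suc N)
pend {N} G u = graph pr ad
  where
  pr : Fin (suc N) → Bool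
  pr zero    = true
  pr (suc i) = present G i
  ad : Fin (suc N) → Fin (suc N) → Bool
  ad zero    zero    = false
  ad zero    (suc j) = j == u
  ad (suc i) zero    = i == u
  ad (suc i) (suc j) = adj G i j

allF : ∀ {N} → (Fin N → Bool) → Bool
allF {zero}  p = true
allF {suc N} p = p zero ∧ allF (λ i → p (suc i))

anyF : ∀ {N} → (Fin N → Bool) → Bool
anyF {zero}  p = false
anyF {suc N} p = p zero ∨ anyF (λ i → p (suc i))

card : ∀ {N} → (Fin N → Bool) → ℕ
card {zero}  S = 0
card {suc N} S = (if S zero then 1 else 0) ℕ.+ card (λ i → S (suc i))

subsets : (N : ℕ) → List (Fin N → Bool)
subsets zero    = (λ ()) ∷ []
subsets (suc N) =
  map (λ S → λ { zero → false ; (suc i) → S i }) (subsets N) ++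
  map (λ S → λ { zero → true  ; (suc i) → S i }) (subsets N)

isDominating : ∀ {N} → Graph N → (Fin N → Bool) → Bool
isDominating G S =
  allF (λ i → not (S i) ∨ present G i) ∧
  allF (λ i → not (present G i) ∨ (S i ∨ anyF (λ j → S j ∧ adj G j i)))

countL : {A : Set} → (A → Bool) → List A → ℕ
countL p []       = 0
countL p (a ∷ as) = (if p a then 1 else 0) ℕ.+ countL p as

-- Polynomials over ℤ as coefficient sequences (all polynomials used
-- below are finitely supported; equality is coefficientwise).

Poly : Set
Poly = ℕ → ℤ

_⊕_ : Poly → Poly → Poly
(p ⊕ q) k = p k ℤ.+ q k
infixl 6 _⊕_ _⊖_

_⊖_ : Poly → Poly → Poly
(p ⊖ q) k = p k ℤ.- q k

sumTo : (ℕ → ℤ) → ℕ → ℤ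
sumTo f zero    = f 0
sumTo f (suc k) = sumTo f k ℤ.+ f (suc k)

_⊗_ : Poly → Poly → Poly
(p ⊗ q) k = sumTo (λ i → p i ℤ.* q (k ℕ.∸ i)) k
infixl 7 _⊗_

const : ℤ → Poly
const c zero    = c
const c (suc k) = + 0

X : Poly
X 1 = + 1
X _ = + 0

D : ∀ {N} → Graph N → Poly
D {N} G k = + countL (λ S → isDominating G S ∧ (card S ≡ᵇ k)) (subsets N)

module Submission where

-- Every graph in the identity consists of the vertices of G (u or v possibly
-- deleted) plus at most two new pendant vertices, so a candidate dominating set
-- is a subset S of V(G) plus a choice of pendant vertices.  Whether it dominates
-- depends on S only through five bits, the configuration of S: are all vertices
-- other than u, v fine, is u ∈ S, is v ∈ S, does u (resp. v) have a neighbour in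
-- S other than v (resp. u).  So each domination polynomial is a sum over subsets
-- S of x^|S|·(a polynomial fixed by the configuration), and as the identity is
-- linear it suffices to prove it for one S: after dividing by x^|S| it is an
-- identity of polynomials of degree ≤ 2, checked in all 32 configurations.

open import Defs
open import Algebra.Bundles using (CommutativeMonoid)
import Algebra.Properties.CommutativeSemigroup as CommutativeSemigroupProperties
open import Data.Bool using (Bool; true; false; _∧_; _∨_; not; if_then_else_)
open import Data.Bool.Properties
  using (∧-assoc; ∧-zeroʳ; ∧-identityʳ; ∨-zeroʳ; ∨-identityʳ; ∧-inverseʳ; ∧-commutativeMonoid; ∨-commutativeMonoid)
open import Data.Empty using (⊥-elim)
open import Data.Fin using (Fin; zero; suc; _≟_)
open import Data.Integer as ℤ using (ℤ; +_)
import Data.Integer.Properties as ℤₚ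
open import Data.List using (List; []; _∷_; map; _++_)
open import Data.Nat as ℕ using (ℕ; zero; suc; _≡ᵇ_; _∸_; _≤_; _<_; z≤n; s≤s; _≤?_)
import Data.Nat.Properties as ℕₚ
open import Data.Product using (_,_)
open import Data.Unit using (tt)
open import Data.Vec.Functional using (tail)
open import Function using (_∘_)
open import Relation.Nullary using (¬_; yes; no)
open import Relation.Nullary.Decidable using (Dec; toWitness; map′; _×-dec_)
open import Relation.Binary.PropositionalEquality
open ≡-Reasoning

private
  module ∧-Props = CommutativeSemigroupProperties (CommutativeMonoid.commutativeSemigroup ∧-commutativeMonoid)
  module ∨-Props = CommutativeSemigroupProperties (CommutativeMonoid.commutativeSemigroup ∨-commutativeMonoid)
  module +-Props = CommutativeSemigroupProperties ℤₚ.+-commutativeSemigroup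

false-disjunct : ∀ b d → (b ∧ false) ∨ d ≡ d
false-disjunct b d = cong (_∨ d) (∧-zeroʳ b)

guarded-cong : ∀ a b {x y} → (a ≡ false → b ≡ false → x ≡ y) → a ∨ (b ∨ x) ≡ a ∨ (b ∨ y)
guarded-cong true  _     _   = refl
guarded-cong false true  _   = refl
guarded-cong false false x≡y = cong (λ z → false ∨ (false ∨ z)) (x≡y refl refl)

==-suc : ∀ {N} (i j : Fin N) → (Fin.suc i == Fin.suc j) ≡ (i == j)
==-suc i j with i ≟ j
... | yes _ = refl
... | no  _ = refl

==-refl : ∀ {N} (i : Fin N) → (i == i) ≡ true
==-refl zero    = refl
==-refl (suc i) = trans (==-suc i i) (==-refl i)

==-false : ∀ {N} (i j : Fin N) → ¬ i ≡ j → (i == j) ≡ false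
==-false i j i≢j with i ≟ j
... | yes i≡j = ⊥-elim (i≢j i≡j)
... | no  _   = refl

allF-cong : ∀ {N} (p q : Fin N → Bool) → (∀ i → p i ≡ q i) → allF p ≡ allF q
allF-cong {zero}  p q p≡q = refl
allF-cong {suc N} p q p≡q = cong₂ _∧_ (p≡q zero) (allF-cong (p ∘ suc) (q ∘ suc) (p≡q ∘ suc))

anyF-cong : ∀ {N} (p q : Fin N → Bool) → (∀ i → p i ≡ q i) → anyF p ≡ anyF q
anyF-cong {zero}  p q p≡q = refl
anyF-cong {suc N} p q p≡q = cong₂ _∨_ (p≡q zero) (anyF-cong (p ∘ suc) (q ∘ suc) (p≡q ∘ suc))

allF-∧ : ∀ {N} (p q : Fin N → Bool) → allF (λ i → p i ∧ q i) ≡ allF p ∧ allF q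
allF-∧ {zero}  p q = refl
allF-∧ {suc N} p q =
  trans (cong ((p zero ∧ q zero) ∧_) (allF-∧ (p ∘ suc) (q ∘ suc)))
        (∧-Props.interchange (p zero) (q zero) (allF (p ∘ suc)) (allF (q ∘ suc)))

anyF-false : ∀ {N} → anyF {N} (λ _ → false) ≡ false
anyF-false {zero}  = refl
anyF-false {suc N} = anyF-false {N}

allF-focus : ∀ {N} (p : Fin N → Bool) (u : Fin N) → allF p ≡ p u ∧ allF (λ i → (i == u) ∨ p i)
allF-focus p zero    = refl
allF-focus p (suc u) = begin
  p zero ∧ allF (p ∘ suc)
    ≡⟨ cong (p zero ∧_) (allF-focus (p ∘ suc) u) ⟩
  p zero ∧ (p (suc u) ∧ allF (λ i → (i == u) ∨ p (suc i)))
    ≡⟨ ∧-Props.x∙yz≈y∙xz (p zero) (p (suc u)) _ ⟩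
  p (suc u) ∧ (p zero ∧ allF (λ i → (i == u) ∨ p (suc i)))
    ≡⟨ cong (λ r → p (suc u) ∧ (p zero ∧ r)) (allF-cong _ _ (λ i → cong (_∨ p (suc i)) (sym (==-suc i u)))) ⟩
  p (suc u) ∧ (p zero ∧ allF (λ i → (suc i == suc u) ∨ p (suc i))) ∎

allF-focus₂ : ∀ {N} (p : Fin N → Bool) (u v : Fin N) → (v == u) ≡ false →
  allF p ≡ p u ∧ (p v ∧ allF (λ i → (i == u) ∨ ((i == v) ∨ p i)))
allF-focus₂ p u v v≠u =
  trans (allF-focus p u) (cong (p u ∧_) (trans (allF-focus (λ i → (i == u) ∨ p i) v)
    (cong₂ _∧_ (cong (_∨ p v) v≠u) (allF-cong _ _ (λ i → ∨-Props.x∙yz≈y∙xz (i == v) (i == u) (p i))))))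

anyF-focus : ∀ {N} (p : Fin N → Bool) (v : Fin N) → anyF p ≡ p v ∨ anyF (λ j → p j ∧ not (j == v))
anyF-focus p zero =
  cong (p zero ∨_) (sym (trans (false-disjunct (p zero) _) (anyF-cong _ _ (λ j → ∧-identityʳ (p (suc j))))))
anyF-focus p (suc v) = begin
  p zero ∨ anyF (p ∘ suc)
    ≡⟨ cong (p zero ∨_) (anyF-focus (p ∘ suc) v) ⟩
  p zero ∨ (p (suc v) ∨ anyF (λ j → p (suc j) ∧ not (j == v)))
    ≡⟨ ∨-Props.x∙yz≈y∙xz (p zero) (p (suc v)) _ ⟩
  p (suc v) ∨ (p zero ∨ anyF (λ j → p (suc j) ∧ not (j == v)))
    ≡⟨ cong (p (suc v) ∨_) (cong₂ _∨_ (sym (∧-identityʳ (p zero)))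
         (anyF-cong _ _ (λ j → cong (λ b → p (suc j) ∧ not b) (sym (==-suc j v))))) ⟩
  p (suc v) ∨ ((p zero ∧ true) ∨ anyF (λ j → p (suc j) ∧ not (suc j == suc v))) ∎

anyF-point : ∀ {N} (S : Fin N → Bool) (w : Fin N) → anyF (λ j → S j ∧ (j == w)) ≡ S w
anyF-point {N} S w = begin
  anyF (λ j → S j ∧ (j == w))
    ≡⟨ anyF-focus _ w ⟩
  (S w ∧ (w == w)) ∨ anyF (λ j → (S j ∧ (j == w)) ∧ not (j == w))
    ≡⟨ cong₂ _∨_ (cong (S w ∧_) (==-refl w)) (trans (anyF-cong _ _ never) (anyF-false {N})) ⟩
  (S w ∧ true) ∨ false
    ≡⟨ trans (∨-identityʳ _) (∧-identityʳ (S w)) ⟩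
  S w ∎
  where
  never : ∀ j → (S j ∧ (j == w)) ∧ not (j == w) ≡ false
  never j = trans (∧-assoc (S j) _ _) (trans (cong (S j ∧_) (∧-inverseʳ (j == w))) (∧-zeroʳ (S j)))

ι : Bool → ℤ
ι true  = + 1
ι false = + 0

∑ : {A : Set} → List A → (A → ℤ) → ℤ
∑ []       f = + 0
∑ (a ∷ as) f = f a ℤ.+ ∑ as f

countL-as-∑ : {A : Set} (p : A → Bool) (xs : List A) → + countL p xs ≡ ∑ xs (λ a → ι (p a))
countL-as-∑ p []       = refl
countL-as-∑ p (a ∷ xs) with p a
... | true  = cong (ℤ._+_ (+ 1)) (countL-as-∑ p xs)
... | false = trans (ℤₚ.+-identityˡ _) (trans (countL-as-∑ p xs) (sym (ℤₚ.+-identityˡ _)))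

∑-cong : {A : Set} {f g : A → ℤ} (xs : List A) → (∀ a → f a ≡ g a) → ∑ xs f ≡ ∑ xs g
∑-cong []       f≡g = refl
∑-cong (x ∷ xs) f≡g = cong₂ ℤ._+_ (f≡g x) (∑-cong xs f≡g)

∑-++ : {A : Set} (xs ys : List A) (f : A → ℤ) → ∑ (xs ++ ys) f ≡ ∑ xs f ℤ.+ ∑ ys f
∑-++ []       ys f = sym (ℤₚ.+-identityˡ _)
∑-++ (x ∷ xs) ys f = trans (cong (ℤ._+_ (f x)) (∑-++ xs ys f)) (sym (ℤₚ.+-assoc (f x) _ _))

∑-map : {A B : Set} (g : A → B) (xs : List A) (f : B → ℤ) → ∑ (map g xs) f ≡ ∑ xs (f ∘ g)
∑-map g []       f = refl
∑-map g (x ∷ xs) f = cong (ℤ._+_ (f (g x))) (∑-map g xs f)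

∑-+ : {A : Set} (xs : List A) (f g : A → ℤ) → ∑ xs f ℤ.+ ∑ xs g ≡ ∑ xs (λ a → f a ℤ.+ g a)
∑-+ []       f g = refl
∑-+ (x ∷ xs) f g =
  trans (+-Props.interchange (f x) _ (g x) _) (cong (ℤ._+_ (f x ℤ.+ g x)) (∑-+ xs f g))

∑-scale : {A : Set} (c : ℤ) (xs : List A) (f : A → ℤ) → c ℤ.* ∑ xs f ≡ ∑ xs (λ a → c ℤ.* f a)
∑-scale c []       f = ℤₚ.*-zeroʳ c
∑-scale c (x ∷ xs) f = trans (ℤₚ.*-distribˡ-+ c (f x) _) (cong (ℤ._+_ (c ℤ.* f x)) (∑-scale c xs f))

∑-neg : {A : Set} (xs : List A) (f : A → ℤ) → ℤ.- ∑ xs f ≡ ∑ xs (λ a → ℤ.- f a)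
∑-neg []       f = refl
∑-neg (x ∷ xs) f = trans (ℤₚ.neg-distrib-+ (f x) _) (cong (ℤ._+_ (ℤ.- f x)) (∑-neg xs f))

∑-- : {A : Set} (xs : List A) (f g : A → ℤ) → ∑ xs f ℤ.- ∑ xs g ≡ ∑ xs (λ a → f a ℤ.- g a)
∑-- xs f g = trans (cong (ℤ._+_ (∑ xs f)) (∑-neg xs g)) (∑-+ xs f (λ a → ℤ.- g a))

sumTo-cong : (f g : ℕ → ℤ) (k : ℕ) → (∀ i → i ≤ k → f i ≡ g i) → sumTo f k ≡ sumTo g k
sumTo-cong f g zero    f≡g = f≡g 0 z≤n
sumTo-cong f g (suc k) f≡g =
  cong₂ ℤ._+_ (sumTo-cong f g k (λ i i≤k → f≡g i (ℕₚ.m≤n⇒m≤1+n i≤k))) (f≡g (suc k) ℕₚ.≤-refl)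

sumTo-zero : (f : ℕ → ℤ) (k : ℕ) → (∀ i → i ≤ k → f i ≡ + 0) → sumTo f k ≡ + 0
sumTo-zero f zero    f≡0 = f≡0 0 z≤n
sumTo-zero f (suc k) f≡0 =
  cong₂ ℤ._+_ (sumTo-zero f k (λ i i≤k → f≡0 i (ℕₚ.m≤n⇒m≤1+n i≤k))) (f≡0 (suc k) ℕₚ.≤-refl)

sumTo-∑ : {A : Set} (g : ℕ → A → ℤ) (xs : List A) (k : ℕ) →
  sumTo (λ i → ∑ xs (g i)) k ≡ ∑ xs (λ a → sumTo (λ i → g i a) k)
sumTo-∑ g xs zero    = refl
sumTo-∑ g xs (suc k) = trans (cong (ℤ._+ ∑ xs (g (suc k))) (sumTo-∑ g xs k)) (∑-+ xs _ _)

record IsShift (p′ p : Poly) : Set where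
  field
    shift-zero : p′ 0 ≡ + 0
    shift-suc  : ∀ k → p′ (suc k) ≡ p k
open IsShift

⊕-shift : ∀ {p′ p q′ q} → IsShift p′ p → IsShift q′ q → IsShift (p′ ⊕ q′) (p ⊕ q)
⊕-shift sp sq = record
  { shift-zero = cong₂ ℤ._+_ (shift-zero sp) (shift-zero sq)
  ; shift-suc  = λ k → cong₂ ℤ._+_ (shift-suc sp k) (shift-suc sq k) }

⊖-shift : ∀ {p′ p q′ q} → IsShift p′ p → IsShift q′ q → IsShift (p′ ⊖ q′) (p ⊖ q)
⊖-shift sp sq = record
  { shift-zero = cong₂ ℤ._-_ (shift-zero sp) (shift-zero sq)
  ; shift-suc  = λ k → cong₂ ℤ._-_ (shift-suc sp k) (shift-suc sq k) }

⊗-shift : ∀ q {p′ p} → IsShift p′ p → IsShift (q ⊗ p′) (q ⊗ p)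
⊗-shift q {p′} {p} sp = record
  { shift-zero = trans (cong (q 0 ℤ.*_) (shift-zero sp)) (ℤₚ.*-zeroʳ (q 0))
  ; shift-suc  = λ k → begin
      sumTo (λ i → q i ℤ.* p′ (suc k ∸ i)) k ℤ.+ q (suc k) ℤ.* p′ (k ∸ k)
        ≡⟨ cong₂ ℤ._+_ (sumTo-cong _ _ k (λ i i≤k → cong (q i ℤ.*_) (lower i i≤k))) (top k) ⟩
      sumTo (λ i → q i ℤ.* p (k ∸ i)) k ℤ.+ + 0
        ≡⟨ ℤₚ.+-identityʳ _ ⟩
      (q ⊗ p) k ∎ }
  where
  lower : ∀ {k} i → i ≤ k → p′ (suc k ∸ i) ≡ p (k ∸ i)
  lower i i≤k = trans (cong p′ (ℕₚ.+-∸-assoc 1 i≤k)) (shift-suc sp _)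
  top : ∀ k → q (suc k) ℤ.* p′ (k ∸ k) ≡ + 0
  top k = trans (cong (λ j → q (suc k) ℤ.* p′ j) (ℕₚ.n∸n≡0 k))
                (trans (cong (q (suc k) ℤ.*_) (shift-zero sp)) (ℤₚ.*-zeroʳ (q (suc k))))

Degree≤ : ℕ → Poly → Set
Degree≤ n p = ∀ k → n < k → p k ≡ + 0

degree-weaken : ∀ {m n p} → m ≤ n → Degree≤ m p → Degree≤ n p
degree-weaken m≤n dp k n<k = dp k (ℕₚ.≤-<-trans m≤n n<k)

const-degree : ∀ c → Degree≤ 0 (const c)
const-degree c (suc k) _ = refl

X-degree : Degree≤ 1 X
X-degree (suc (suc k)) _         = refl
X-degree (suc zero)    (s≤s ())

⊕-degree : ∀ {n p q} → Degree≤ n p → Degree≤ n q → Degree≤ n (p ⊕ q)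
⊕-degree dp dq k n<k = cong₂ ℤ._+_ (dp k n<k) (dq k n<k)

⊖-degree : ∀ {n p q} → Degree≤ n p → Degree≤ n q → Degree≤ n (p ⊖ q)
⊖-degree dp dq k n<k = cong₂ ℤ._-_ (dp k n<k) (dq k n<k)

-- Degrees add under multiplication: in (q ⊗ p) k = Σ_{i≤k} q i · p (k-i), every
-- term has i > a or k - i > b when k > a + b.
⊗-degree : ∀ {a b q p} → Degree≤ a q → Degree≤ b p → Degree≤ (a ℕ.+ b) (q ⊗ p)
⊗-degree {a} {b} {q} {p} dq dp k a+b<k = sumTo-zero _ k (λ i _ → term i)
  where
  term : ∀ i → q i ℤ.* p (k ∸ i) ≡ + 0
  term i with i ≤? a
  ... | no  i≰a = trans (cong (ℤ._* p (k ∸ i)) (dq i (ℕₚ.≰⇒> i≰a))) (ℤₚ.*-zeroˡ (p (k ∸ i)))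
  ... | yes i≤a = trans (cong (q i ℤ.*_) (dp (k ∸ i) b<k∸i)) (ℤₚ.*-zeroʳ (q i))
    where
    b<k∸i : b < k ∸ i
    b<k∸i = ℕₚ.m+n≤o⇒m≤o∸n (suc b)
              (ℕₚ.≤-<-trans (ℕₚ.+-monoʳ-≤ b i≤a) (subst (_< k) (ℕₚ.+-comm a b) a+b<k))

record Expansion {A : Set} (xs : List A) (P : Poly) (F : A → Poly) : Set where
  constructor expansion
  field coefficient : ∀ k → P k ≡ ∑ xs (λ a → F a k)
open Expansion

module _ {A : Set} {xs : List A} where

  ⊕-expansion : ∀ {P Q F G} → Expansion xs P F → Expansion xs Q G → Expansion xs (P ⊕ Q) (λ a → F a ⊕ G a)
  ⊕-expansion {F = F} {G} eP eQ = expansion λ k →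
    trans (cong₂ ℤ._+_ (coefficient eP k) (coefficient eQ k)) (∑-+ xs (λ a → F a k) (λ a → G a k))

  ⊖-expansion : ∀ {P Q F G} → Expansion xs P F → Expansion xs Q G → Expansion xs (P ⊖ Q) (λ a → F a ⊖ G a)
  ⊖-expansion {F = F} {G} eP eQ = expansion λ k →
    trans (cong₂ ℤ._-_ (coefficient eP k) (coefficient eQ k)) (∑-- xs (λ a → F a k) (λ a → G a k))

  ⊗-expansion : ∀ q {P F} → Expansion xs P F → Expansion xs (q ⊗ P) (λ a → q ⊗ F a)
  ⊗-expansion q {P} {F} eP = expansion λ k →
    trans (sumTo-cong _ _ k (λ i _ → trans (cong (q i ℤ.*_) (coefficient eP (k ∸ i))) (∑-scale (q i) xs _)))
          (sumTo-∑ (λ i a → q i ℤ.* F a (k ∸ i)) xs k)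

1+x 1-x : Poly
1+x = const (+ 1) ⊕ X
1-x = const (+ 1) ⊖ X

lhs : Poly → Poly
lhs P = 1+x ⊗ 1+x ⊗ P

rhs : (P-v P-u P+u-v P-e+u P-u+v P-e+v P-e P-e+u+v P-u-v : Poly) → Poly
rhs P-v P-u P+u-v P-e+u P-u+v P-e+v P-e P-e+u+v P-u-v =
  X ⊗ 1+x ⊗ (P-v ⊕ P-u)
  ⊕ 1-x ⊗ P+u-v
  ⊖ 1+x ⊗ P-e+u
  ⊕ 1-x ⊗ P-u+v
  ⊖ 1+x ⊗ P-e+v
  ⊕ 1+x ⊗ 1+x ⊗ P-e
  ⊕ const (+ 2) ⊗ P-e+u+v
  ⊖ const (+ 2) ⊗ X ⊗ P-u-v

lhs-expansion : ∀ {A} {xs : List A} {P F} → Expansion xs P F → Expansion xs (lhs P) (lhs ∘ F)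
lhs-expansion = ⊗-expansion (1+x ⊗ 1+x)

rhs-expansion : ∀ {A} {xs : List A} {P₁ P₂ P₃ P₄ P₅ P₆ P₇ P₈ P₉ F₁ F₂ F₃ F₄ F₅ F₆ F₇ F₈ F₉} →
  Expansion xs P₁ F₁ → Expansion xs P₂ F₂ → Expansion xs P₃ F₃ → Expansion xs P₄ F₄ →
  Expansion xs P₅ F₅ → Expansion xs P₆ F₆ → Expansion xs P₇ F₇ → Expansion xs P₈ F₈ →
  Expansion xs P₉ F₉ →
  Expansion xs (rhs P₁ P₂ P₃ P₄ P₅ P₆ P₇ P₈ P₉)
               (λ a → rhs (F₁ a) (F₂ a) (F₃ a) (F₄ a) (F₅ a) (F₆ a) (F₇ a) (F₈ a) (F₉ a))
rhs-expansion e₁ e₂ e₃ e₄ e₅ e₆ e₇ e₈ e₉ =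
  ⊖-expansion (⊕-expansion (⊕-expansion (⊖-expansion (⊕-expansion (⊖-expansion (⊕-expansion
    (⊗-expansion (X ⊗ 1+x) (⊕-expansion e₁ e₂)) (⊗-expansion 1-x e₃)) (⊗-expansion 1+x e₄))
    (⊗-expansion 1-x e₅)) (⊗-expansion 1+x e₆)) (⊗-expansion (1+x ⊗ 1+x) e₇))
    (⊗-expansion (const (+ 2)) e₈)) (⊗-expansion (const (+ 2) ⊗ X) e₉)

lhs-shift : ∀ {P′ P} → IsShift P′ P → IsShift (lhs P′) (lhs P)
lhs-shift = ⊗-shift (1+x ⊗ 1+x)

rhs-shift : ∀ {P₁ P₂ P₃ P₄ P₅ P₆ P₇ P₈ P₉ P₁′ P₂′ P₃′ P₄′ P₅′ P₆′ P₇′ P₈′ P₉′} →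
  IsShift P₁′ P₁ → IsShift P₂′ P₂ → IsShift P₃′ P₃ → IsShift P₄′ P₄ → IsShift P₅′ P₅ →
  IsShift P₆′ P₆ → IsShift P₇′ P₇ → IsShift P₈′ P₈ → IsShift P₉′ P₉ →
  IsShift (rhs P₁′ P₂′ P₃′ P₄′ P₅′ P₆′ P₇′ P₈′ P₉′) (rhs P₁ P₂ P₃ P₄ P₅ P₆ P₇ P₈ P₉)
rhs-shift s₁ s₂ s₃ s₄ s₅ s₆ s₇ s₈ s₉ =
  ⊖-shift (⊕-shift (⊕-shift (⊖-shift (⊕-shift (⊖-shift (⊕-shift
    (⊗-shift (X ⊗ 1+x) (⊕-shift s₁ s₂)) (⊗-shift 1-x s₃)) (⊗-shift 1+x s₄))
    (⊗-shift 1-x s₅)) (⊗-shift 1+x s₆)) (⊗-shift (1+x ⊗ 1+x) s₇))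
    (⊗-shift (const (+ 2)) s₈)) (⊗-shift (const (+ 2) ⊗ X) s₉)

-- Degree bounds for both sides, for inputs of the degrees that occur for a
-- single subset of size 0 (each pendant vertex may raise the degree by one).

1+x-degree : Degree≤ 1 1+x
1+x-degree = ⊕-degree (degree-weaken z≤n (const-degree _)) X-degree

1-x-degree : Degree≤ 1 1-x
1-x-degree = ⊖-degree (degree-weaken z≤n (const-degree _)) X-degree

lhs-degree : ∀ {P} → Degree≤ 0 P → Degree≤ 2 (lhs P)
lhs-degree dP = ⊗-degree (⊗-degree 1+x-degree 1+x-degree) dP

rhs-degree : ∀ {P₁ P₂ P₃ P₄ P₅ P₆ P₇ P₈ P₉} →
  Degree≤ 0 P₁ → Degree≤ 0 P₂ → Degree≤ 1 P₃ → Degree≤ 1 P₄ → Degree≤ 1 P₅ →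
  Degree≤ 1 P₆ → Degree≤ 0 P₇ → Degree≤ 2 P₈ → Degree≤ 0 P₉ →
  Degree≤ 2 (rhs P₁ P₂ P₃ P₄ P₅ P₆ P₇ P₈ P₉)
rhs-degree d₁ d₂ d₃ d₄ d₅ d₆ d₇ d₈ d₉ =
  ⊖-degree (⊕-degree (⊕-degree (⊖-degree (⊕-degree (⊖-degree (⊕-degree
    (⊗-degree (⊗-degree X-degree 1+x-degree) (⊕-degree d₁ d₂)) (⊗-degree 1-x-degree d₃))
    (⊗-degree 1+x-degree d₄)) (⊗-degree 1-x-degree d₅)) (⊗-degree 1+x-degree d₆))
    (⊗-degree (⊗-degree 1+x-degree 1+x-degree) d₇)) (⊗-degree (const-degree _) d₈))
    (degree-weaken (s≤s z≤n) (⊗-degree (⊗-degree (const-degree _) X-degree) d₉))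

record Config : Set where
  constructor config
  field
    rest  : Bool  -- every vertex other than u, v satisfies its domination condition
    inU   : Bool
    inV   : Bool
    nbrU  : Bool  -- u has a neighbour in S other than v
    nbrV  : Bool  -- v has a neighbour in S other than u

-- When S (plus the pendant vertices p at u and q at v, where present) dominates
-- each graph of the identity.  The conjuncts are, in order: the pendant
-- vertices, u, v and the remaining vertices.

dom-G dom-G-v dom-G-u dom-G-e dom-G-u-v : Config → Bool
dom-G     (config R su sv du dv) = (su ∨ (sv ∨ du)) ∧ ((sv ∨ (su ∨ dv)) ∧ R)
dom-G-v   (config R su sv du dv) = (su ∨ (sv ∨ du)) ∧ (not sv ∧ R)
dom-G-u   (config R su sv du dv) = not su ∧ ((sv ∨ (su ∨ dv)) ∧ R)
dom-G-e   (config R su sv du dv) = (su ∨ du) ∧ ((sv ∨ dv) ∧ R)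
dom-G-u-v (config R su sv du dv) = not su ∧ (not sv ∧ R)

dom-G+u-v dom-G-e+u dom-G-u+v dom-G-e+v : Config → Bool → Bool
dom-G+u-v (config R su sv du dv) p = (p ∨ su) ∧ ((su ∨ (p ∨ (sv ∨ du))) ∧ (not sv ∧ R))
dom-G-e+u (config R su sv du dv) p = (p ∨ su) ∧ ((su ∨ (p ∨ du)) ∧ ((sv ∨ dv) ∧ R))
dom-G-u+v (config R su sv du dv) q = (q ∨ sv) ∧ (not su ∧ ((sv ∨ (q ∨ (su ∨ dv))) ∧ R))
dom-G-e+v (config R su sv du dv) q = (q ∨ sv) ∧ ((su ∨ du) ∧ ((sv ∨ (q ∨ dv)) ∧ R))

dom-G-e+u+v : Config → Bool → Bool → Bool
dom-G-e+u+v (config R su sv du dv) p q =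
  (q ∨ sv) ∧ ((p ∨ su) ∧ ((su ∨ (p ∨ du)) ∧ ((sv ∨ (q ∨ dv)) ∧ R)))

mono : ℕ → Bool → Poly
mono c b k = ι (b ∧ (c ≡ᵇ k))

pendantPart : ℕ → (Bool → Bool) → Poly
pendantPart c φ = mono c (φ false) ⊕ mono (suc c) (φ true)

twoPendantPart : ℕ → (Bool → Bool → Bool) → Poly
twoPendantPart c φ = pendantPart c (φ false) ⊕ pendantPart (suc c) (φ true)

mono-shift : ∀ c b → IsShift (mono (suc c) b) (mono c b)
mono-shift c b = record { shift-zero = cong ι (∧-zeroʳ b) ; shift-suc = λ _ → refl }

pendantPart-shift : ∀ c φ → IsShift (pendantPart (suc c) φ) (pendantPart c φ)
pendantPart-shift c φ = ⊕-shift (mono-shift c (φ false)) (mono-shift (suc c) (φ true))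

twoPendantPart-shift : ∀ c φ → IsShift (twoPendantPart (suc c) φ) (twoPendantPart c φ)
twoPendantPart-shift c φ = ⊕-shift (pendantPart-shift c (φ false)) (pendantPart-shift (suc c) (φ true))

≡ᵇ-< : ∀ {m n} → m < n → (m ≡ᵇ n) ≡ false
≡ᵇ-< {zero}  {suc n} _         = refl
≡ᵇ-< {suc m} {suc n} (s≤s m<n) = ≡ᵇ-< m<n

mono-degree : ∀ c b → Degree≤ c (mono c b)
mono-degree c b k c<k = cong ι (trans (cong (b ∧_) (≡ᵇ-< c<k)) (∧-zeroʳ b))

pendantPart-degree : ∀ c φ → Degree≤ (suc c) (pendantPart c φ)
pendantPart-degree c φ =
  ⊕-degree (degree-weaken (ℕₚ.n≤1+n c) (mono-degree c (φ false))) (mono-degree (suc c) (φ true))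

twoPendantPart-degree : ∀ c φ → Degree≤ (suc (suc c)) (twoPendantPart c φ)
twoPendantPart-degree c φ =
  ⊕-degree (degree-weaken (ℕₚ.n≤1+n (suc c)) (pendantPart-degree c (φ false)))
           (pendantPart-degree (suc c) (φ true))

localLHS localRHS : Config → ℕ → Poly
localLHS σ c = lhs (mono c (dom-G σ))
localRHS σ c = rhs (mono c (dom-G-v σ)) (mono c (dom-G-u σ)) (pendantPart c (dom-G+u-v σ))
  (pendantPart c (dom-G-e+u σ)) (pendantPart c (dom-G-u+v σ)) (pendantPart c (dom-G-e+v σ))
  (mono c (dom-G-e σ)) (twoPendantPart c (dom-G-e+u+v σ)) (mono c (dom-G-u-v σ))

localLHS-shift : ∀ σ c → IsShift (localLHS σ (suc c)) (localLHS σ c)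
localLHS-shift σ c = lhs-shift (mono-shift c (dom-G σ))

localRHS-shift : ∀ σ c → IsShift (localRHS σ (suc c)) (localRHS σ c)
localRHS-shift σ c = rhs-shift
  (mono-shift c (dom-G-v σ)) (mono-shift c (dom-G-u σ)) (pendantPart-shift c (dom-G+u-v σ))
  (pendantPart-shift c (dom-G-e+u σ)) (pendantPart-shift c (dom-G-u+v σ)) (pendantPart-shift c (dom-G-e+v σ))
  (mono-shift c (dom-G-e σ)) (twoPendantPart-shift c (dom-G-e+u+v σ)) (mono-shift c (dom-G-u-v σ))

localLHS-degree : ∀ σ → Degree≤ 2 (localLHS σ 0)
localLHS-degree σ = lhs-degree (mono-degree 0 (dom-G σ))

localRHS-degree : ∀ σ → Degree≤ 2 (localRHS σ 0)
localRHS-degree σ = rhs-degree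
  (mono-degree 0 (dom-G-v σ)) (mono-degree 0 (dom-G-u σ)) (pendantPart-degree 0 (dom-G+u-v σ))
  (pendantPart-degree 0 (dom-G-e+u σ)) (pendantPart-degree 0 (dom-G-u+v σ)) (pendantPart-degree 0 (dom-G-e+v σ))
  (mono-degree 0 (dom-G-e σ)) (twoPendantPart-degree 0 (dom-G-e+u+v σ)) (mono-degree 0 (dom-G-u-v σ))

∀Bool? : {P : Bool → Set} → (∀ b → Dec (P b)) → Dec (∀ b → P b)
∀Bool? P? = map′ (λ { (pf , pt) false → pf ; (pf , pt) true → pt }) (λ h → h false , h true)
                 (P? false ×-dec P? true)

∀Config? : {P : Config → Set} → (∀ σ → Dec (P σ)) → Dec (∀ σ → P σ)
∀Config? P? = map′ (λ h σ → h (Config.rest σ) (Config.inU σ) (Config.inV σ) (Config.nbrU σ) (Config.nbrV σ))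
                   (λ h R su sv du dv → h (config R su sv du dv))
                   (∀Bool? λ R → ∀Bool? λ su → ∀Bool? λ sv → ∀Bool? λ du → ∀Bool? λ dv →
                      P? (config R su sv du dv))

localAgreement : ∀ k → Dec (∀ σ → localLHS σ 0 k ≡ localRHS σ 0 k)
localAgreement k = ∀Config? (λ σ → localLHS σ 0 k ℤ.≟ localRHS σ 0 k)

localIdentity-size0 : ∀ σ k → localLHS σ 0 k ≡ localRHS σ 0 k
localIdentity-size0 σ 0 = toWitness {a? = localAgreement 0} tt σ
localIdentity-size0 σ 1 = toWitness {a? = localAgreement 1} tt σ
localIdentity-size0 σ 2 = toWitness {a? = localAgreement 2} tt σ
localIdentity-size0 σ k@(suc (suc (suc _))) = trans (localLHS-degree σ k 2<k) (sym (localRHS-degree σ k 2<k))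
  where
  2<k : 2 < k
  2<k = s≤s (s≤s (s≤s z≤n))

-- The local identity for sets of every size, by shifting down to size 0.
localIdentity : ∀ σ c k → localLHS σ c k ≡ localRHS σ c k
localIdentity σ zero    k       = localIdentity-size0 σ k
localIdentity σ (suc c) zero    = trans (shift-zero (localLHS-shift σ c)) (sym (shift-zero (localRHS-shift σ c)))
localIdentity σ (suc c) (suc k) = begin
  localLHS σ (suc c) (suc k) ≡⟨ shift-suc (localLHS-shift σ c) k ⟩
  localLHS σ c k             ≡⟨ localIdentity σ c k ⟩
  localRHS σ c k             ≡⟨ shift-suc (localRHS-shift σ c) k ⟨
  localRHS σ (suc c) (suc k) ∎

-- Subsets of Fin (suc M) are subsets S of Fin M, without and with the vertex 0.
∑-subsets-suc : ∀ {M} (f : (Fin (suc M) → Bool) → ℤ) (g : Bool → (Fin M → Bool) → ℤ) →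
  (∀ T → f T ≡ g (T zero) (tail T)) →
  ∑ (subsets (suc M)) f ≡ ∑ (subsets M) (λ S → g false S ℤ.+ g true S)
∑-subsets-suc {M} f g f≡g = begin
  ∑ (map _ (subsets M) ++ map _ (subsets M)) f
    ≡⟨ ∑-++ (map _ (subsets M)) _ f ⟩
  ∑ (map _ (subsets M)) f ℤ.+ ∑ (map _ (subsets M)) f
    ≡⟨ cong₂ ℤ._+_ (trans (∑-map _ (subsets M) f) (∑-cong (subsets M) (λ S → f≡g _)))
                   (trans (∑-map _ (subsets M) f) (∑-cong (subsets M) (λ S → f≡g _))) ⟩
  ∑ (subsets M) (g false) ℤ.+ ∑ (subsets M) (g true)
    ≡⟨ ∑-+ (subsets M) (g false) (g true) ⟩
  ∑ (subsets M) (λ S → g false S ℤ.+ g true S) ∎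

expandD : ∀ {M} (H : Graph M) (φ : (Fin M → Bool) → Bool) → (∀ S → isDominating H S ≡ φ S) →
  Expansion (subsets M) (D H) (λ S → mono (card S) (φ S))
expandD {M} H φ dom = expansion λ k → trans (countL-as-∑ _ (subsets M))
  (∑-cong (subsets M) (λ S → cong (λ b → ι (b ∧ (card S ≡ᵇ k))) (dom S)))

expandD-pendant : ∀ {M} (H : Graph (suc M)) (φ : Bool → (Fin M → Bool) → Bool) →
  (∀ T → isDominating H T ≡ φ (T zero) (tail T)) →
  Expansion (subsets M) (D H) (λ S → pendantPart (card S) (λ p → φ p S))
expandD-pendant {M} H φ dom = expansion λ k → trans (countL-as-∑ _ (subsets (suc M)))
  (∑-subsets-suc _ (λ p S → ι (φ p S ∧ ((if p then 1 else 0) ℕ.+ card S ≡ᵇ k)))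
                 (λ T → cong (λ b → ι (b ∧ (card T ≡ᵇ k))) (dom T)))

expandD-twoPendant : ∀ {M} (H : Graph (suc (suc M))) (φ : Bool → Bool → (Fin M → Bool) → Bool) →
  (∀ T → isDominating H T ≡ φ (T (suc zero)) (T zero) (tail (tail T))) →
  Expansion (subsets M) (D H) (λ S → twoPendantPart (card S) (λ p q → φ p q S))
expandD-twoPendant {M} H φ dom = expansion λ k → begin
  + countL _ (subsets (suc (suc M)))
    ≡⟨ countL-as-∑ _ (subsets (suc (suc M))) ⟩
  ∑ (subsets (suc (suc M))) _
    ≡⟨ ∑-subsets-suc _ (λ q T → indicator k (T zero) q (tail T) (if q then 1 else 0))
                       (λ T → cong (λ b → ι (b ∧ (card T ≡ᵇ k))) (dom T)) ⟩
  ∑ (subsets (suc M)) _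
    ≡⟨ ∑-subsets-suc _ (λ p S → indicator k p false S 0 ℤ.+ indicator k p true S 1) (λ T → refl) ⟩
  ∑ (subsets M) (λ S → twoPendantPart (card S) (λ p q → φ p q S) k) ∎
  where
  indicator : ℕ → Bool → Bool → (Fin M → Bool) → ℕ → ℤ
  indicator k p q S c = ι (φ p q S ∧ (c ℕ.+ ((if p then 1 else 0) ℕ.+ card S) ≡ᵇ k))

vertexCondition : (inS present nbrInS : Bool) → Bool
vertexCondition s p d = (not s ∨ p) ∧ (not p ∨ (s ∨ d))

vertexOK : ∀ {M} (H : Graph M) (S : Fin M → Bool) → Fin M → Bool
vertexOK H S i = vertexCondition (S i) (present H i) (anyF (λ j → S j ∧ adj H j i))

isDominating-vertexwise : ∀ {M} (H : Graph M) (S : Fin M → Bool) → isDominating H S ≡ allF (vertexOK H S)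
isDominating-vertexwise H S =
  sym (allF-∧ (λ i → not (S i) ∨ present H i) (λ i → not (present H i) ∨ (S i ∨ anyF (λ j → S j ∧ adj H j i))))

vertexCondition-present : ∀ {p d} s t → p ≡ true → d ≡ t → vertexCondition s p d ≡ s ∨ t
vertexCondition-present s t refl refl = cong (_∧ (s ∨ t)) (∨-zeroʳ (not s))

vertexCondition-absent : ∀ {p} s d → p ≡ false → vertexCondition s p d ≡ not s
vertexCondition-absent s d refl = trans (∧-identityʳ _) (∨-identityʳ (not s))

pendantVertex-ok : ∀ {d} p s → d ≡ s → vertexCondition p true ((p ∧ false) ∨ d) ≡ p ∨ s
pendantVertex-ok p s d≡s = vertexCondition-present p s refl (trans (false-disjunct p _) d≡s)

pendantNbr-yes : ∀ {iw d} p t → iw ≡ true → d ≡ t → (p ∧ iw) ∨ d ≡ p ∨ t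
pendantNbr-yes p t refl refl = cong (_∨ t) (∧-identityʳ p)

pendantNbr-no : ∀ {iw d} p t → iw ≡ false → d ≡ t → (p ∧ iw) ∨ d ≡ t
pendantNbr-no p t refl refl = false-disjunct p t

stillPresent : ∀ {M} (H : Graph M) {i w} → (i == w) ≡ false → present (delV H w) i ≡ present H i
stillPresent H {i} i≠w = trans (cong (λ b → present H i ∧ not b) i≠w) (∧-identityʳ _)

deletedAbsent : ∀ {M} (H : Graph M) {i w} → (i == w) ≡ true → present (delV H w) i ≡ false
deletedAbsent H {i} i=w = trans (cong (λ b → present H i ∧ not b) i=w) (∧-zeroʳ _)

module EdgeAnalysis {N} (G : Graph N) (simple : IsSimple G) (u v : Fin N) (uv-edge : IsEdge G u v) where
  open IsSimple simple
  open IsEdge uv-edge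

  u≢v : ¬ u ≡ v
  u≢v refl with trans (sym uv-adj) (adj-irrefl u)
  ... | ()

  u≠v : (u == v) ≡ false
  u≠v = ==-false u v u≢v

  v≠u : (v == u) ≡ false
  v≠u = ==-false v u (u≢v ∘ sym)

  vu-adj : adj G v u ≡ true
  vu-adj = trans (adj-sym v u) uv-adj

  Rest : (Fin N → Bool) → Bool
  Rest S = allF (λ i → (i == u) ∨ ((i == v) ∨ vertexOK G S i))

  nbrU nbrV : (Fin N → Bool) → Bool
  nbrU S = anyF (λ j → (S j ∧ adj G j u) ∧ not (j == v))
  nbrV S = anyF (λ j → (S j ∧ adj G j v) ∧ not (j == u))

  configOf : (Fin N → Bool) → Config
  configOf S = config (Rest S) (S u) (S v) (nbrU S) (nbrV S)

  split-at-edge : ∀ (q S : Fin N → Bool) {x y} → q u ≡ x → q v ≡ y →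
    (∀ i → (i == u) ≡ false → (i == v) ≡ false → q i ≡ vertexOK G S i) →
    allF q ≡ x ∧ (y ∧ Rest S)
  split-at-edge q S qu qv q-elsewhere = trans (allF-focus₂ q u v v≠u)
    (cong₂ _∧_ qu (cong₂ _∧_ qv
      (allF-cong _ _ (λ i → guarded-cong (i == u) (i == v) (q-elsewhere i)))))

  nbrsOf-u : ∀ S → anyF (λ j → S j ∧ adj G j u) ≡ S v ∨ nbrU S
  nbrsOf-u S = trans (anyF-focus _ v) (cong (_∨ nbrU S) (trans (cong (S v ∧_) vu-adj) (∧-identityʳ (S v))))

  nbrsOf-v : ∀ S → anyF (λ j → S j ∧ adj G j v) ≡ S u ∨ nbrV S
  nbrsOf-v S = trans (anyF-focus _ u) (cong (_∨ nbrV S) (trans (cong (S u ∧_) uv-adj) (∧-identityʳ (S u))))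

  private
    removed : Fin N → Fin N → Bool
    removed j i = ((j == u) ∧ (i == v)) ∨ ((j == v) ∧ (i == u))

    removed-at-u : ∀ j → removed j u ≡ (j == v)
    removed-at-u j = trans (cong₂ (λ a b → ((j == u) ∧ a) ∨ ((j == v) ∧ b)) u≠v (==-refl u))
                           (trans (false-disjunct (j == u) _) (∧-identityʳ (j == v)))

    removed-at-v : ∀ j → removed j v ≡ (j == u)
    removed-at-v j = trans (cong₂ (λ a b → ((j == u) ∧ a) ∨ ((j == v) ∧ b)) (==-refl v) v≠u)
                           (trans (cong₂ _∨_ (∧-identityʳ (j == u)) (∧-zeroʳ (j == v))) (∨-identityʳ (j == u)))

    removed-elsewhere : ∀ i → (i == u) ≡ false → (i == v) ≡ false → ∀ j → removed j i ≡ false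
    removed-elsewhere i i≠u i≠v j = trans (cong₂ (λ a b → ((j == u) ∧ a) ∨ ((j == v) ∧ b)) i≠v i≠u)
                                          (trans (false-disjunct (j == u) _) (∧-zeroʳ (j == v)))

  nbrsOf-u-in-G-e : ∀ S → anyF (λ j → S j ∧ adj (delE G u v) j u) ≡ nbrU S
  nbrsOf-u-in-G-e S = anyF-cong _ _ (λ j →
    trans (cong (λ r → S j ∧ (adj G j u ∧ not r)) (removed-at-u j)) (sym (∧-assoc (S j) _ _)))

  nbrsOf-v-in-G-e : ∀ S → anyF (λ j → S j ∧ adj (delE G u v) j v) ≡ nbrV S
  nbrsOf-v-in-G-e S = anyF-cong _ _ (λ j →
    trans (cong (λ r → S j ∧ (adj G j v ∧ not r)) (removed-at-v j)) (sym (∧-assoc (S j) _ _)))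

  nbrsElsewhere-in-G-e : ∀ (S : Fin N → Bool) i → (i == u) ≡ false → (i == v) ≡ false →
    anyF (λ j → S j ∧ adj (delE G u v) j i) ≡ anyF (λ j → S j ∧ adj G j i)
  nbrsElsewhere-in-G-e S i i≠u i≠v = anyF-cong (λ j → S j ∧ adj (delE G u v) j i) (λ j → S j ∧ adj G j i) (λ j →
    cong (S j ∧_) (trans (cong (λ r → adj G j i ∧ not r) (removed-elsewhere i i≠u i≠v j)) (∧-identityʳ _)))

  dominating-G : ∀ S → isDominating G S ≡ dom-G (configOf S)
  dominating-G S = trans (isDominating-vertexwise G S) (split-at-edge _ S
    (vertexCondition-present (S u) _ u-present (nbrsOf-u S))
    (vertexCondition-present (S v) _ v-present (nbrsOf-v S))
    (λ _ _ _ → refl))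

  dominating-G-v : ∀ S → isDominating (delV G v) S ≡ dom-G-v (configOf S)
  dominating-G-v S = trans (isDominating-vertexwise (delV G v) S) (split-at-edge _ S
    (vertexCondition-present (S u) _ (trans (stillPresent G u≠v) u-present) (nbrsOf-u S))
    (vertexCondition-absent (S v) _ (deletedAbsent G (==-refl v)))
    (λ i _ i≠v → cong₂ (vertexCondition (S i)) (stillPresent G i≠v) refl))

  dominating-G-u : ∀ S → isDominating (delV G u) S ≡ dom-G-u (configOf S)
  dominating-G-u S = trans (isDominating-vertexwise (delV G u) S) (split-at-edge _ S
    (vertexCondition-absent (S u) _ (deletedAbsent G (==-refl u)))
    (vertexCondition-present (S v) _ (trans (stillPresent G v≠u) v-present) (nbrsOf-v S))
    (λ i i≠u _ → cong₂ (vertexCondition (S i)) (stillPresent G i≠u) refl))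

  dominating-G-e : ∀ S → isDominating (delE G u v) S ≡ dom-G-e (configOf S)
  dominating-G-e S = trans (isDominating-vertexwise (delE G u v) S) (split-at-edge _ S
    (vertexCondition-present (S u) _ u-present (nbrsOf-u-in-G-e S))
    (vertexCondition-present (S v) _ v-present (nbrsOf-v-in-G-e S))
    (λ i i≠u i≠v → cong (vertexCondition (S i) (present G i)) (nbrsElsewhere-in-G-e S i i≠u i≠v)))

  dominating-G-u-v : ∀ S → isDominating (delV (delV G u) v) S ≡ dom-G-u-v (configOf S)
  dominating-G-u-v S = trans (isDominating-vertexwise (delV (delV G u) v) S) (split-at-edge _ S
    (vertexCondition-absent (S u) _ (trans (stillPresent (delV G u) u≠v) (deletedAbsent G (==-refl u))))
    (vertexCondition-absent (S v) _ (deletedAbsent (delV G u) (==-refl v)))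
    (λ i i≠u i≠v → cong₂ (vertexCondition (S i)) (trans (stillPresent (delV G u) i≠v) (stillPresent G i≠u)) refl))

  dominating-G+u-v : ∀ T → isDominating (delV (pend G u) (suc v)) T ≡ dom-G+u-v (configOf (tail T)) (T zero)
  dominating-G+u-v T = trans (isDominating-vertexwise (delV (pend G u) (suc v)) T) (cong₂ _∧_
    (pendantVertex-ok p (S u) (anyF-point S u))
    (split-at-edge _ S
      (vertexCondition-present (S u) _ (trans (stillPresent (pend G u) (trans (==-suc u v) u≠v)) u-present)
                                       (pendantNbr-yes p _ (==-refl u) (nbrsOf-u S)))
      (vertexCondition-absent (S v) _ (deletedAbsent (pend G u) (==-refl (suc v))))
      (λ i i≠u i≠v → cong₂ (vertexCondition (S i)) (stillPresent (pend G u) (trans (==-suc i v) i≠v))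
                                                   (pendantNbr-no p _ i≠u refl))))
    where
    p = T zero
    S = tail T

  dominating-G-e+u : ∀ T → isDominating (pend (delE G u v) u) T ≡ dom-G-e+u (configOf (tail T)) (T zero)
  dominating-G-e+u T = trans (isDominating-vertexwise (pend (delE G u v) u) T) (cong₂ _∧_
    (pendantVertex-ok p (S u) (anyF-point S u))
    (split-at-edge _ S
      (vertexCondition-present (S u) _ u-present (pendantNbr-yes p _ (==-refl u) (nbrsOf-u-in-G-e S)))
      (vertexCondition-present (S v) _ v-present (pendantNbr-no p _ v≠u (nbrsOf-v-in-G-e S)))
      (λ i i≠u i≠v → cong (vertexCondition (S i) (present G i))
                          (pendantNbr-no p _ i≠u (nbrsElsewhere-in-G-e S i i≠u i≠v)))))
    where
    p = T zero
    S = tail T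

  dominating-G-u+v : ∀ T → isDominating (pend (delV G u) v) T ≡ dom-G-u+v (configOf (tail T)) (T zero)
  dominating-G-u+v T = trans (isDominating-vertexwise (pend (delV G u) v) T) (cong₂ _∧_
    (pendantVertex-ok q (S v) (anyF-point S v))
    (split-at-edge _ S
      (vertexCondition-absent (S u) _ (deletedAbsent G (==-refl u)))
      (vertexCondition-present (S v) _ (trans (stillPresent G v≠u) v-present)
                                       (pendantNbr-yes q _ (==-refl v) (nbrsOf-v S)))
      (λ i i≠u i≠v → cong₂ (vertexCondition (S i)) (stillPresent G i≠u) (pendantNbr-no q _ i≠v refl))))
    where
    q = T zero
    S = tail T

  dominating-G-e+v : ∀ T → isDominating (pend (delE G u v) v) T ≡ dom-G-e+v (configOf (tail T)) (T zero)
  dominating-G-e+v T = trans (isDominating-vertexwise (pend (delE G u v) v) T) (cong₂ _∧_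
    (pendantVertex-ok q (S v) (anyF-point S v))
    (split-at-edge _ S
      (vertexCondition-present (S u) _ u-present (pendantNbr-no q _ u≠v (nbrsOf-u-in-G-e S)))
      (vertexCondition-present (S v) _ v-present (pendantNbr-yes q _ (==-refl v) (nbrsOf-v-in-G-e S)))
      (λ i i≠u i≠v → cong (vertexCondition (S i) (present G i))
                          (pendantNbr-no q _ i≠v (nbrsElsewhere-in-G-e S i i≠u i≠v)))))
    where
    q = T zero
    S = tail T

  -- With two pendant vertices, 0 hangs at v and 1 hangs at u.
  dominating-G-e+u+v : ∀ T → isDominating (pend (pend (delE G u v) u) (suc v)) T
                             ≡ dom-G-e+u+v (configOf (tail (tail T))) (T (suc zero)) (T zero)
  dominating-G-e+u+v T = trans (isDominating-vertexwise (pend (pend (delE G u v) u) (suc v)) T) (cong₂ _∧_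
    (pendantVertex-ok q (S v) (trans (false-disjunct p _)
      (trans (anyF-cong _ _ (λ j → cong (S j ∧_) (==-suc j v))) (anyF-point S v))))
    (cong₂ _∧_
      (vertexCondition-present p (S u) refl (trans (false-disjunct q _) (trans (false-disjunct p _) (anyF-point S u))))
      (split-at-edge _ S
        (vertexCondition-present (S u) _ u-present
          (pendantNbr-no q _ (trans (==-suc u v) u≠v) (pendantNbr-yes p _ (==-refl u) (nbrsOf-u-in-G-e S))))
        (vertexCondition-present (S v) _ v-present
          (pendantNbr-yes q _ (trans (==-suc v v) (==-refl v)) (pendantNbr-no p _ v≠u (nbrsOf-v-in-G-e S))))
        (λ i i≠u i≠v → cong (vertexCondition (S i) (present G i))
          (pendantNbr-no q _ (trans (==-suc i v) i≠v) (pendantNbr-no p _ i≠u (nbrsElsewhere-in-G-e S i i≠u i≠v)))))))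
    where
    q = T zero
    p = T (suc zero)
    S = tail (tail T)

  expansion-G : Expansion (subsets N) (D G) (λ S → mono (card S) (dom-G (configOf S)))
  expansion-G = expandD G _ dominating-G

  expansion-G-v : Expansion (subsets N) (D (delV G v)) (λ S → mono (card S) (dom-G-v (configOf S)))
  expansion-G-v = expandD (delV G v) _ dominating-G-v

  expansion-G-u : Expansion (subsets N) (D (delV G u)) (λ S → mono (card S) (dom-G-u (configOf S)))
  expansion-G-u = expandD (delV G u) _ dominating-G-u

  expansion-G+u-v : Expansion (subsets N) (D (delV (pend G u) (suc v)))
                              (λ S → pendantPart (card S) (dom-G+u-v (configOf S)))
  expansion-G+u-v = expandD-pendant (delV (pend G u) (suc v)) (λ p S → dom-G+u-v (configOf S) p) dominating-G+u-v

  expansion-G-e+u : Expansion (subsets N) (D (pend (delE G u v) u))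
                              (λ S → pendantPart (card S) (dom-G-e+u (configOf S)))
  expansion-G-e+u = expandD-pendant (pend (delE G u v) u) (λ p S → dom-G-e+u (configOf S) p) dominating-G-e+u

  expansion-G-u+v : Expansion (subsets N) (D (pend (delV G u) v))
                              (λ S → pendantPart (card S) (dom-G-u+v (configOf S)))
  expansion-G-u+v = expandD-pendant (pend (delV G u) v) (λ p S → dom-G-u+v (configOf S) p) dominating-G-u+v

  expansion-G-e+v : Expansion (subsets N) (D (pend (delE G u v) v))
                              (λ S → pendantPart (card S) (dom-G-e+v (configOf S)))
  expansion-G-e+v = expandD-pendant (pend (delE G u v) v) (λ p S → dom-G-e+v (configOf S) p) dominating-G-e+v

  expansion-G-e : Expansion (subsets N) (D (delE G u v)) (λ S → mono (card S) (dom-G-e (configOf S)))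
  expansion-G-e = expandD (delE G u v) _ dominating-G-e

  expansion-G-e+u+v : Expansion (subsets N) (D (pend (pend (delE G u v) u) (suc v)))
                                (λ S → twoPendantPart (card S) (dom-G-e+u+v (configOf S)))
  expansion-G-e+u+v = expandD-twoPendant (pend (pend (delE G u v) u) (suc v))
    (λ p q S → dom-G-e+u+v (configOf S) p q) dominating-G-e+u+v

  expansion-G-u-v : Expansion (subsets N) (D (delV (delV G u) v)) (λ S → mono (card S) (dom-G-u-v (configOf S)))
  expansion-G-u-v = expandD (delV (delV G u) v) _ dominating-G-u-v

mainTheorem9 : ∀ {N : ℕ} (G : Graph N) → IsSimple G → (u v : Fin N) → IsEdge G u v →
    ∀ (k : ℕ) →
      ((const (+ 1) ⊕ X) ⊗ (const (+ 1) ⊕ X) ⊗ D G) k ≡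
      (X ⊗ (const (+ 1) ⊕ X) ⊗ (D (delV G v) ⊕ D (delV G u))
        ⊕ (const (+ 1) ⊖ X) ⊗ D (delV (pend G u) (suc v))
        ⊖ (const (+ 1) ⊕ X) ⊗ D (pend (delE G u v) u)
        ⊕ (const (+ 1) ⊖ X) ⊗ D (pend (delV G u) v)
        ⊖ (const (+ 1) ⊕ X) ⊗ D (pend (delE G u v) v)
        ⊕ (const (+ 1) ⊕ X) ⊗ (const (+ 1) ⊕ X) ⊗ D (delE G u v)
        ⊕ const (+ 2) ⊗ D (pend (pend (delE G u v) u) (suc v))
        ⊖ const (+ 2) ⊗ X ⊗ D (delV (delV G u) v)) k
mainTheorem9 {N} G simple u v uv-edge k = begin
  lhs (D G) k
    ≡⟨ coefficient (lhs-expansion expansion-G) k ⟩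
  ∑ (subsets N) (λ S → localLHS (configOf S) (card S) k)
    ≡⟨ ∑-cong (subsets N) (λ S → localIdentity (configOf S) (card S) k) ⟩
  ∑ (subsets N) (λ S → localRHS (configOf S) (card S) k)
    ≡⟨ coefficient (rhs-expansion expansion-G-v expansion-G-u expansion-G+u-v expansion-G-e+u
         expansion-G-u+v expansion-G-e+v expansion-G-e expansion-G-e+u+v expansion-G-u-v) k ⟨
  rhs (D (delV G v)) (D (delV G u)) (D (delV (pend G u) (suc v))) (D (pend (delE G u v) u))
      (D (pend (delV G u) v)) (D (pend (delE G u v) v)) (D (delE G u v))
      (D (pend (pend (delE G u v) u) (suc v))) (D (delV (delV G u) v)) k ∎
  where open EdgeAnalysis G simple u v uv-edge
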